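{- Let $n_1,n_2\geq 1$ and $T=\{(x_1,\dots,x_{n_1},y_1,\dots,y_{n_2})\in\mathbb{R}^{n_1+n_2}: x_i>0,\ y_j>0 \text{ for all } i,j\}$. Then the probabilistic communication complexity of recognizing $T$ is at most $4$.
   Context: Coordinates are $(X,Y)=(X_1,\dots,X_{n_1},Y_1,\dots,Y_{n_2})$. A (real) communication protocol is a finite rooted tree. To each non-leaf vertex $v$ is attached either a polynomial $a_v(X)\in\mathbb{R}[X]$ (computed by the first party) or $b_v(Y)\in\mathbb{R}[Y]$ (computed by the second party). If $q_1,\dots,q_r$ are the polynomials attached to the vertices on the path from the root to $v$ (including $v$), then $v$ carries finitely many testing polynomials $P_{v,j}\in\mathbb{R}[Q_1,\dots,Q_r]$, and on input $(x,y)$ the computation branches according to the signs ($<0,=0,>0$) of $P_{v,j}(q_1(x,y),\dots,q_r(x,y))$. Leaves are labelled "accept"/"reject". A probabilistic communication protocol is a finite family of such protocols $C_i$ chosen with probabilities $p_i\geq 0$, $\sum p_i=1$, such that for every input the output correctly decides membership in the set with probability greater than $2/3$; its complexity is the maximal depth of the $C_i$, and the probabilistic communication complexity of a set is the minimum of this over probabilistic protocols recognizing it. -}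

module Defs where

open import Data.Nat using (ℕ; zero; suc)
open import Data.Fin using (Fin; zero; suc)
open import Data.Bool using (Bool; true; false; _∧_)
open import Data.Sum using (_⊎_; inj₁; inj₂)
open import Data.Product using (Σ; _×_; _,_)
open import Data.Empty using (⊥)
open import Relation.Nullary using (¬_)
open import Relation.Binary using (Tri; tri<; tri≈; tri>)
open import Relation.Binary.Structures using (IsStrictTotalOrder)
open import Relation.Binary.PropositionalEquality using (_≡_)
open import Algebra.Structures using (IsCommutativeRing)

-- An axiomatic model of the real numbers: a complete ordered field
-- (with propositional equality on the carrier).  Any such structure is
-- (isomorphic to) ℝ, so quantifying over all of them is faithful to ℝ.

record RealField : Set₁ where
  infixl 6 _+_
  infixl 7 _*_
  infix  4 _<_
  field
    Carrier : Set
    _+_ _*_ : Carrier → Carrier → Carrier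
    -_      : Carrier → Carrier
    0# 1#   : Carrier
    _<_     : Carrier → Carrier → Set
    isCommutativeRing : IsCommutativeRing _≡_ _+_ _*_ -_ 0# 1#
    inverse : (a : Carrier) → ¬ (a ≡ 0#) → Σ Carrier (λ b → a * b ≡ 1#)
    0≢1     : ¬ (0# ≡ 1#)
    isStrictTotalOrder : IsStrictTotalOrder _≡_ _<_
    +-mono-< : ∀ {a b} c → a < b → a + c < b + c
    *-pos    : ∀ {a b} → 0# < a → 0# < b → 0# < a * b
    complete : (S : Carrier → Set) → Σ Carrier S →
               Σ Carrier (λ u → ∀ s → S s → (s < u ⊎ s ≡ u)) →
               Σ Carrier (λ l → (∀ s → S s → (s < l ⊎ s ≡ l)) ×
                                (∀ u → (∀ s → S s → (s < u ⊎ s ≡ u)) → (l < u ⊎ l ≡ u)))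

  _≤_ : Carrier → Carrier → Set
  a ≤ b = a < b ⊎ a ≡ b

module Over (R : RealField) where
  open RealField R
  open IsStrictTotalOrder isStrictTotalOrder using (compare)

  data Poly (n : ℕ) : Set where
    var   : Fin n → Poly n
    const : Carrier → Poly n
    _⊕_   : Poly n → Poly n → Poly n
    _⊗_   : Poly n → Poly n → Poly n

  eval : ∀ {n} → Poly n → (Fin n → Carrier) → Carrier
  eval (var i)   v = v i
  eval (const c) v = c
  eval (p ⊕ q)   v = eval p v + eval q v
  eval (p ⊗ q)   v = eval p v * eval q v

  data Sign : Set where
    neg zer pos : Sign

  sign : Carrier → Sign
  sign a with compare a 0#
  ... | tri< _ _ _ = neg
  ... | tri≈ _ _ _ = zer
  ... | tri> _ _ _ = pos

  snoc : ∀ {r} → (Fin r → Carrier) → Carrier → Fin (suc r) → Carrier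
  snoc {zero}  v c zero    = c
  snoc {suc r} v c zero    = v zero
  snoc {suc r} v c (suc i) = snoc (λ j → v (suc j)) c i

  -- Communication protocols.  'Protocol n₁ n₂ r' is a subtree whose root
  -- has r polynomials q₁..q_r attached on the path strictly above it.
  -- A node carries a polynomial in X (inj₁) or in Y (inj₂), k testing
  -- polynomials in ℝ[Q₁..Q_{r+1}], and a child for each sign pattern.
  data Protocol (n₁ n₂ : ℕ) : ℕ → Set where
    leaf : ∀ {r} → Bool → Protocol n₁ n₂ r      -- true = accept
    node : ∀ {r} → (q : Poly n₁ ⊎ Poly n₂) → (k : ℕ) →
           (tests : Fin k → Poly (suc r)) →
           (child : (Fin k → Sign) → Protocol n₁ n₂ (suc r)) →
           Protocol n₁ n₂ r

  evalQ : ∀ {n₁ n₂} → Poly n₁ ⊎ Poly n₂ →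
          (Fin n₁ → Carrier) → (Fin n₂ → Carrier) → Carrier
  evalQ (inj₁ a) x y = eval a x
  evalQ (inj₂ b) x y = eval b y

  run : ∀ {n₁ n₂ r} → Protocol n₁ n₂ r → (Fin r → Carrier) →
        (Fin n₁ → Carrier) → (Fin n₂ → Carrier) → Bool
  run (leaf b) qs x y = b
  run (node q k tests child) qs x y =
    let qs' = snoc qs (evalQ q x y) in
    run (child (λ j → sign (eval (tests j) qs'))) qs' x y

  data DepthLeq {n₁ n₂} : ∀ {r} → ℕ → Protocol n₁ n₂ r → Set where
    leaf≤ : ∀ {r d b} → DepthLeq {r = r} d (leaf b)
    node≤ : ∀ {r d q k tests child} →
            (∀ s → DepthLeq d (child s)) →
            DepthLeq {r = r} (suc d) (node q k tests child)

  sumR : ∀ {m} → (Fin m → Carrier) → Carrier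
  sumR {zero}  f = 0#
  sumR {suc m} f = f zero + sumR (λ i → f (suc i))

  -- a subset of ℝ^{n₁+n₂}, given with a membership decision (Bool)
  -- so that "the output is correct" is a decidable event.
  Subset : ℕ → ℕ → Set
  Subset n₁ n₂ = (Fin n₁ → Carrier) → (Fin n₂ → Carrier) → Bool

  beq : Bool → Bool → Bool
  beq true  true  = true
  beq false false = true
  beq _     _     = false

  two three : Carrier
  two   = 1# + 1#
  three = 1# + 1# + 1#

  if-correct : Bool → Carrier → Carrier
  if-correct true  a = a
  if-correct false a = 0#

  record ProbProtocol (n₁ n₂ : ℕ) (S : Subset n₁ n₂) (d : ℕ) : Set where
    field
      m     : ℕ
      C     : Fin m → Protocol n₁ n₂ zero
      p     : Fin m → Carrier
      p≥0   : ∀ i → 0# ≤ p i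
      sum=1 : sumR p ≡ 1#
      depth : ∀ i → DepthLeq d (C i)
      -- probability of a correct answer exceeds 2/3:  3·Pr > 2
      correct : ∀ x y →
        two < three * sumR (λ i →
          if-correct (beq (run (C i) (λ ()) x y) (S x y)) (p i))

  ProbCC≤ : ∀ n₁ n₂ → Subset n₁ n₂ → ℕ → Set
  ProbCC≤ n₁ n₂ S d = ProbProtocol n₁ n₂ S d

  isPos : Carrier → Bool
  isPos a with compare 0# a
  ... | tri< _ _ _ = true
  ... | tri≈ _ _ _ = false
  ... | tri> _ _ _ = false

  allPos : ∀ {n} → (Fin n → Carrier) → Bool
  allPos {zero}  v = true
  allPos {suc n} v = isPos (v zero) ∧ allPos (λ i → v (suc i))

  T : ∀ n₁ n₂ → Subset n₁ n₂
  T n₁ n₂ x y = allPos x ∧ allPos y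

-- A party holding x decides the sign of a subproduct ∏_{i∈S} x_i in one round.  If every x_i > 0
-- all 2^n subproducts are positive; otherwise at most half of them are, by induction on the first
-- coordinate x₀: the subsets containing x₀ have as many positive subproducts as the others if x₀ > 0,
-- none if x₀ = 0, and as many as the others have negative ones if x₀ < 0.  The protocol draws two
-- uniform subsets of the x-coordinates and two of the y-coordinates and accepts iff all four
-- subproducts are positive: it never errs on T, and off T it accepts with probability at most 1/4 < 1/3.

module Submission where

open import Defs
open import Data.Nat using (ℕ; _≤_)

open import Algebra.Bundles using (Ring)
open import Algebra.Structures using (IsCommutativeRing; IsRing)
import Algebra.Properties.Ring as RingProperties
import Algebra.Properties.Semiring.Mult as SemiringMult
open import Data.Bool using (Bool; true; false; _∧_; not; if_then_else_)
open import Data.Bool.ListAction using (all)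
open import Data.Bool.Properties using (∧-assoc; ∧-identityʳ)
open import Data.Empty using (⊥-elim)
open import Data.Fin using (zero; fromℕ)
open import Data.List using (List; []; _∷_; _++_; map; length; cartesianProduct; lookup)
open import Data.List.Properties using (length-++; length-map)
import Data.Nat as Nat
import Data.Nat.Properties as ℕₚ
open import Data.Product using (Σ; _×_; _,_; proj₁; proj₂)
open import Data.Sum using (_⊎_; inj₁; inj₂)
open import Data.Vec.Functional using (Vector; head; tail) renaming (_∷_ to _∷ᵛ_)
open import Function using (_∘_)
open import Relation.Binary using (tri<; tri≈; tri>)
open import Relation.Binary.Bundles using (StrictPartialOrder)
import Relation.Binary.Reasoning.StrictPartialOrder as StrictReasoning
open import Relation.Binary.Structures using (IsStrictTotalOrder)
open import Relation.Binary.PropositionalEquality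
open import Relation.Nullary using (¬_)
open import Data.Nat.Tactic.RingSolver using (solve-∀)

module Arithmetic where
  open Nat using (zero; suc; _+_; _*_; _<_)

  4*m≤n⇒3*m<n : ∀ m {n} → 4 * m ≤ n → 0 < n → 3 * m < n
  4*m≤n⇒3*m<n zero    _     0<n = 0<n
  4*m≤n⇒3*m<n (suc m) 4m≤n  _   = ℕₚ.<-≤-trans (ℕₚ.*-monoˡ-< (suc m) (ℕₚ.n<1+n 3)) 4m≤n

  twoThirds-of : ∀ e c {n} → e + c ≡ n → 3 * e < n → 2 * n < 3 * c
  twoThirds-of e c {n} e+c≡n 3e<n = ℕₚ.+-cancelʳ-< (3 * e) (2 * n) (3 * c) (begin-strict
    2 * n + 3 * e  <⟨ ℕₚ.+-monoʳ-< (2 * n) 3e<n ⟩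
    2 * n + n      ≡⟨ ℕₚ.+-comm (2 * n) n ⟩
    3 * n          ≡⟨ cong (3 *_) e+c≡n ⟨
    3 * (e + c)    ≡⟨ ℕₚ.*-distribˡ-+ 3 e c ⟩
    3 * e + 3 * c  ≡⟨ ℕₚ.+-comm (3 * e) (3 * c) ⟩
    3 * c + 3 * e  ∎)
    where open ℕₚ.≤-Reasoning

  quarter-of-product : ∀ a b {m k} → 2 * a ≤ m → b ≤ k → 4 * ((a * a) * (b * b)) ≤ (m * m) * (k * k)
  quarter-of-product a b 2a≤m b≤k = ℕₚ.≤-trans (ℕₚ.≤-reflexive (reassociate a b))
    (ℕₚ.*-mono-≤ (ℕₚ.*-mono-≤ 2a≤m 2a≤m) (ℕₚ.*-mono-≤ b≤k b≤k))
    where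
      reassociate : ∀ a b → 4 * ((a * a) * (b * b)) ≡ ((2 * a) * (2 * a)) * (b * b)
      reassociate = solve-∀

open Arithmetic

module Counting where
  open Nat using (zero; suc; _+_; _*_; _^_; s≤s)
  open ≡-Reasoning

  count : {A : Set} → (A → Bool) → List A → ℕ
  count f []       = 0
  count f (a ∷ as) = if f a then suc (count f as) else count f as

  module _ {A : Set} where

    count-++ : (f : A → Bool) (as bs : List A) → count f (as ++ bs) ≡ count f as + count f bs
    count-++ f []       bs = refl
    count-++ f (a ∷ as) bs with f a
    ... | true  = cong suc (count-++ f as bs)
    ... | false = count-++ f as bs

    count-cong : {f g : A → Bool} → (∀ a → f a ≡ g a) → (as : List A) → count f as ≡ count g as
    count-cong         f≗g []       = refl
    count-cong {g = g} f≗g (a ∷ as) rewrite f≗g a =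
      cong (λ n → if g a then suc n else n) (count-cong f≗g as)

    count-none : {f : A → Bool} → (∀ a → f a ≡ false) → (as : List A) → count f as ≡ 0
    count-none f≗false []       = refl
    count-none f≗false (a ∷ as) rewrite f≗false a = count-none f≗false as

    count-true : (as : List A) → count (λ _ → true) as ≡ length as
    count-true []       = refl
    count-true (a ∷ as) = cong suc (count-true as)

    count≤length : (f : A → Bool) (as : List A) → count f as ≤ length as
    count≤length f []       = Nat.z≤n
    count≤length f (a ∷ as) with f a
    ... | true  = s≤s (count≤length f as)
    ... | false = ℕₚ.m≤n⇒m≤1+n (count≤length f as)

    count-disjoint : {f g : A → Bool} → (∀ a → f a ∧ g a ≡ false) → (as : List A) →
                     count f as + count g as ≤ length as
    count-disjoint         disjoint []       = Nat.z≤n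
    count-disjoint {f} {g} disjoint (a ∷ as) with f a | g a | disjoint a
    ... | true  | false | _ = s≤s (count-disjoint disjoint as)
    ... | false | false | _ = ℕₚ.m≤n⇒m≤1+n (count-disjoint disjoint as)
    ... | false | true  | _ rewrite ℕₚ.+-suc (count f as) (count g as) =
      s≤s (count-disjoint disjoint as)

    count-not : (f : A → Bool) (as : List A) → count (not ∘ f) as + count f as ≡ length as
    count-not f []       = refl
    count-not f (a ∷ as) with f a
    ... | true  = trans (ℕₚ.+-suc _ _) (cong suc (count-not f as))
    ... | false = cong suc (count-not f as)

  count-map : {A B : Set} (f : B → Bool) (g : A → B) (as : List A) →
              count f (map g as) ≡ count (f ∘ g) as
  count-map f g []       = refl
  count-map f g (a ∷ as) with f (g a)
  ... | true  = cong suc (count-map f g as)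
  ... | false = count-map f g as

  count-cartesianProduct : {A B : Set} (f : A → Bool) (g : B → Bool) (as : List A) (bs : List B) →
    count (λ p → f (proj₁ p) ∧ g (proj₂ p)) (cartesianProduct as bs) ≡ count f as * count g bs
  count-cartesianProduct f g []       bs = refl
  count-cartesianProduct {A} {B} f g (a ∷ as) bs = begin
    count h (map (a ,_) bs ++ cartesianProduct as bs)
      ≡⟨ count-++ h (map (a ,_) bs) (cartesianProduct as bs) ⟩
    count h (map (a ,_) bs) + count h (cartesianProduct as bs)
      ≡⟨ cong₂ _+_ (count-map h (a ,_) bs) (count-cartesianProduct f g as bs) ⟩
    count (λ b → f a ∧ g b) bs + count f as * count g bs
      ≡⟨ head-factor (f a) refl ⟩
    count f (a ∷ as) * count g bs ∎
    where
      h : A × B → Bool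
      h p = f (proj₁ p) ∧ g (proj₂ p)
      head-factor : ∀ t → f a ≡ t →
        count (λ b → t ∧ g b) bs + count f as * count g bs ≡ count f (a ∷ as) * count g bs
      head-factor true  fa≡true  rewrite fa≡true  = refl
      head-factor false fa≡false rewrite fa≡false =
        cong (_+ count f as * count g bs) (count-none (λ _ → refl) bs)

  length-cartesianProduct : {A B : Set} (as : List A) (bs : List B) →
                            length (cartesianProduct as bs) ≡ length as * length bs
  length-cartesianProduct as bs = begin
    length (cartesianProduct as bs)                     ≡⟨ count-true (cartesianProduct as bs) ⟨
    count (λ _ → true) (cartesianProduct as bs)         ≡⟨ count-cartesianProduct _ _ as bs ⟩
    count (λ _ → true) as * count (λ _ → true) bs       ≡⟨ cong₂ _*_ (count-true as) (count-true bs) ⟩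
    length as * length bs                               ∎

  subsets : (n : ℕ) → List (Vector Bool n)
  subsets zero    = (λ ()) ∷ []
  subsets (suc n) = map (true ∷ᵛ_) (subsets n) ++ map (false ∷ᵛ_) (subsets n)

  length-subsets : (n : ℕ) → length (subsets n) ≡ 2 ^ n
  length-subsets zero    = refl
  length-subsets (suc n) = begin
    length (map (true ∷ᵛ_) (subsets n) ++ map (false ∷ᵛ_) (subsets n))
      ≡⟨ length-++ (map (true ∷ᵛ_) (subsets n)) ⟩
    length (map (true ∷ᵛ_) (subsets n)) + length (map (false ∷ᵛ_) (subsets n))
      ≡⟨ cong₂ _+_ (length-map _ (subsets n)) (length-map _ (subsets n)) ⟩
    length (subsets n) + length (subsets n)
      ≡⟨ cong₂ _+_ (length-subsets n) (length-subsets n) ⟩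
    2 ^ n + 2 ^ n
      ≡⟨ cong (2 ^ n +_) (ℕₚ.+-identityʳ (2 ^ n)) ⟨
    2 ^ suc n ∎

open Counting

subproduct : {A : Set} → (A → A → A) → A → ∀ {n} → Vector A n → Vector Bool n → A
subproduct         _·_ e {Nat.zero}  xs s = e
subproduct {A = A} _·_ e {Nat.suc n} xs s = if head s then head xs · rest else rest
  where
    rest : A
    rest = subproduct _·_ e (tail xs) (tail s)

module OrderedField (R : RealField) where
  open RealField R hiding (_≤_)
  open Over R using (isPos)
  open IsStrictTotalOrder isStrictTotalOrder public
    using (compare; irrefl; asym) renaming (trans to <-trans)
  open IsCommutativeRing isCommutativeRing using (isRing)
  open IsRing isRing public
    using (+-comm; +-assoc; +-identityˡ; +-identityʳ; *-identityˡ; zeroˡ; zeroʳ; -‿inverseˡ; -‿inverseʳ)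

  ring : Ring _ _
  ring = record { isRing = isRing }

  open RingProperties ring using (-‿distribˡ-*; -‿distribʳ-*; -‿involutive)

  x<y+x : ∀ {x y} → 0# < y → x < y + x
  x<y+x {x} {y} 0<y = subst (_< y + x) (+-identityˡ x) (+-mono-< x 0<y)

  x<x+y : ∀ {x y} → 0# < y → x < x + y
  x<x+y {x} {y} 0<y = subst (x <_) (+-comm y x) (x<y+x 0<y)

  +-pos : ∀ {x y} → 0# < x → 0# < y → 0# < x + y
  +-pos 0<x 0<y = <-trans 0<y (x<y+x 0<x)

  x<0⇒0<-x : ∀ {x} → x < 0# → 0# < - x
  x<0⇒0<-x {x} x<0 = subst₂ _<_ (-‿inverseʳ x) (+-identityˡ (- x)) (+-mono-< (- x) x<0)

  0<-x⇒x<0 : ∀ {x} → 0# < - x → x < 0#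
  0<-x⇒x<0 {x} 0<-x = subst₂ _<_ (+-identityˡ x) (-‿inverseˡ x) (+-mono-< x 0<-x)

  -x*-y≡x*y : ∀ x y → - x * - y ≡ x * y
  -x*-y≡x*y x y = begin
    - x * - y     ≡⟨ -‿distribˡ-* x (- y) ⟨
    - (x * - y)   ≡⟨ cong -_ (-‿distribʳ-* x y) ⟨
    - - (x * y)   ≡⟨ -‿involutive (x * y) ⟩
    x * y         ∎
    where open ≡-Reasoning

  0<1 : 0# < 1#
  0<1 with compare 0# 1#
  ... | tri< 0<1 _   _ = 0<1
  ... | tri≈ _   0≡1 _ = ⊥-elim (0≢1 0≡1)
  ... | tri> 1≮0 _ 1<0 = ⊥-elim (1≮0 (subst (0# <_) 1*1≡1 (*-pos (x<0⇒0<-x 1<0) (x<0⇒0<-x 1<0))))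
    where
      1*1≡1 : - 1# * - 1# ≡ 1#
      1*1≡1 = trans (-x*-y≡x*y 1# 1#) (*-identityˡ 1#)

  *-cancelˡ-pos : ∀ {x y} → 0# < x → 0# < x * y → 0# < y
  *-cancelˡ-pos {x} {y} 0<x 0<xy with compare 0# y
  ... | tri< 0<y _   _   = 0<y
  ... | tri≈ _   0≡y _   = ⊥-elim (irrefl (sym (trans (cong (x *_) (sym 0≡y)) (zeroʳ x))) 0<xy)
  ... | tri> _   _   y<0 = ⊥-elim (asym 0<xy (0<-x⇒x<0 0<-xy))
    where
      0<-xy : 0# < - (x * y)
      0<-xy = subst (0# <_) (sym (-‿distribʳ-* x y)) (*-pos 0<x (x<0⇒0<-x y<0))

  positive-inverse : ∀ {x} → 0# < x → Σ Carrier (λ y → x * y ≡ 1# × 0# < y)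
  positive-inverse {x} 0<x with inverse x (λ x≡0 → irrefl (sym x≡0) 0<x)
  ... | y , xy≡1 = y , xy≡1 , *-cancelˡ-pos 0<x (subst (0# <_) (sym xy≡1) 0<1)

  isPos-true : ∀ {x} → 0# < x → isPos x ≡ true
  isPos-true {x} 0<x with compare 0# x
  ... | tri< _ _ _     = refl
  ... | tri≈ 0≮x _ _   = ⊥-elim (0≮x 0<x)
  ... | tri> 0≮x _ _   = ⊥-elim (0≮x 0<x)

  isPos-false : ∀ {x} → ¬ 0# < x → isPos x ≡ false
  isPos-false {x} 0≮x with compare 0# x
  ... | tri< 0<x _ _ = ⊥-elim (0≮x 0<x)
  ... | tri≈ _ _ _   = refl
  ... | tri> _ _ _   = refl

  isPos-cong : ∀ {x y} → (0# < x → 0# < y) → (0# < y → 0# < x) → isPos x ≡ isPos y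
  isPos-cong {x} x⇒y y⇒x with compare 0# x
  ... | tri< 0<x _ _ = sym (isPos-true (x⇒y 0<x))
  ... | tri≈ 0≮x _ _ = sym (isPos-false (0≮x ∘ y⇒x))
  ... | tri> 0≮x _ _ = sym (isPos-false (0≮x ∘ y⇒x))

  isPos-*-pos : ∀ {x} y → 0# < x → isPos (x * y) ≡ isPos y
  isPos-*-pos y 0<x = isPos-cong (*-cancelˡ-pos 0<x) (*-pos 0<x)

  isPos-*-neg : ∀ {x} y → x < 0# → isPos (x * y) ≡ isPos (- y)
  isPos-*-neg {x} y x<0 = trans (cong isPos (sym (-x*-y≡x*y x y))) (isPos-*-pos (- y) (x<0⇒0<-x x<0))

  isPos-*-zero : ∀ {x} y → 0# ≡ x → isPos (x * y) ≡ false
  isPos-*-zero y refl = isPos-false (λ 0<0y → irrefl (sym (zeroˡ y)) 0<0y)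

  isPos[-x]∧isPos[x]≡false : ∀ x → isPos (- x) ∧ isPos x ≡ false
  isPos[-x]∧isPos[x]≡false x with compare 0# (- x)
  ... | tri< 0<-x _ _ = isPos-false (λ 0<x → asym 0<x (0<-x⇒x<0 0<-x))
  ... | tri≈ _ _ _    = refl
  ... | tri> _ _ _    = refl

  open SemiringMult (Ring.semiring ring) public using (×-homo-+; ×-assocˡ; ×-assoc-*) renaming (_×_ to _·_)

  ×-pos : ∀ {n x} → 0 Nat.< n → 0# < x → 0# < n · x
  ×-pos {Nat.suc Nat.zero}    {x} _ 0<x = subst (0# <_) (sym (+-identityʳ x)) 0<x
  ×-pos {Nat.suc (Nat.suc n)}     _ 0<x = +-pos 0<x (×-pos {Nat.suc n} Nat.z<s 0<x)

  ×-monoˡ-< : ∀ {x m n} → 0# < x → m Nat.< n → m · x < n · x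
  ×-monoˡ-< {x} {m} {n} 0<x m<n = subst (m · x <_) m·x+k·x≡n·x (x<x+y (×-pos {Nat.suc k} Nat.z<s 0<x))
    where
      k : ℕ
      k = n Nat.∸ Nat.suc m
      m·x+k·x≡n·x : m · x + Nat.suc k · x ≡ n · x
      m·x+k·x≡n·x = trans (sym (×-homo-+ x m (Nat.suc k)))
        (cong (_· x) (trans (ℕₚ.+-suc m k) (ℕₚ.m+[n∸m]≡n m<n)))

  <-strictPartialOrder : StrictPartialOrder _ _ _
  <-strictPartialOrder = record
    { isStrictPartialOrder = IsStrictTotalOrder.isStrictPartialOrder isStrictTotalOrder }

module Recognition (R : RealField) where
  open RealField R hiding (_≤_)
  open Over R
  open OrderedField R
  open Nat using (_^_)

  ∏ : ∀ {n} → Vector Carrier n → Vector Bool n → Carrier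
  ∏ = subproduct _*_ 1#

  monomial : ∀ {n} → Vector Bool n → Poly n
  monomial = subproduct _⊗_ (const 1#) var

  eval-subproduct : ∀ {m n} (ps : Vector (Poly m) n) (s : Vector Bool n) v →
                    eval (subproduct _⊗_ (const 1#) ps s) v ≡ ∏ (λ i → eval (ps i) v) s
  eval-subproduct {n = Nat.zero}  ps s v = refl
  eval-subproduct {n = Nat.suc n} ps s v with head s
  ... | true  = cong (eval (head ps) v *_) (eval-subproduct (tail ps) (tail s) v)
  ... | false = eval-subproduct (tail ps) (tail s) v

  eval-monomial : ∀ {n} (s : Vector Bool n) v → eval (monomial s) v ≡ ∏ v s
  eval-monomial s v = eval-subproduct var s v

  positiveSubproducts : ∀ {n} → Vector Carrier n → ℕ
  positiveSubproducts {n} v = count (isPos ∘ ∏ v) (subsets n)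

  scaledPositiveSubproducts : ∀ {n} → Carrier → Vector Carrier n → ℕ
  scaledPositiveSubproducts {n} a v = count (λ s → isPos (a * ∏ v s)) (subsets n)

  positiveSubproducts-suc : ∀ {n} (v : Vector Carrier (Nat.suc n)) →
    positiveSubproducts v ≡ scaledPositiveSubproducts (head v) (tail v) Nat.+ positiveSubproducts (tail v)
  positiveSubproducts-suc {n} v = trans (count-++ (isPos ∘ ∏ v) (map (true ∷ᵛ_) (subsets n)) _)
    (cong₂ Nat._+_ (count-map (isPos ∘ ∏ v) (true ∷ᵛ_) (subsets n))
                   (count-map (isPos ∘ ∏ v) (false ∷ᵛ_) (subsets n)))

  positiveSubproducts≤ : ∀ {n} (v : Vector Carrier n) → positiveSubproducts v ≤ 2 ^ n
  positiveSubproducts≤ {n} v = subst (positiveSubproducts v ≤_) (length-subsets n) (count≤length _ (subsets n))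

  allPos⇒isPos-∏ : ∀ {n} (v : Vector Carrier n) → allPos v ≡ true → ∀ s → isPos (∏ v s) ≡ true
  allPos⇒isPos-∏ {Nat.zero}  v _ s = isPos-true 0<1
  allPos⇒isPos-∏ {Nat.suc n} v allPos-v s with compare 0# (head v) | head s
  ... | tri< 0<v₀ _ _ | true  = trans (isPos-*-pos _ 0<v₀) (allPos⇒isPos-∏ (tail v) allPos-v (tail s))
  ... | tri< 0<v₀ _ _ | false = allPos⇒isPos-∏ (tail v) allPos-v (tail s)

  scaledPositiveSubproducts-pos : ∀ {n a} (v : Vector Carrier n) → 0# < a →
                                  scaledPositiveSubproducts a v ≡ positiveSubproducts v
  scaledPositiveSubproducts-pos {n} v 0<a = count-cong (λ s → isPos-*-pos (∏ v s) 0<a) (subsets n)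

  scaledPositiveSubproducts-zero : ∀ {n a} (v : Vector Carrier n) → 0# ≡ a → scaledPositiveSubproducts a v ≡ 0
  scaledPositiveSubproducts-zero {n} v 0≡a = count-none (λ s → isPos-*-zero (∏ v s) 0≡a) (subsets n)

  scaledPositiveSubproducts-neg : ∀ {n a} (v : Vector Carrier n) → a < 0# →
                                  scaledPositiveSubproducts a v Nat.+ positiveSubproducts v ≤ 2 ^ n
  scaledPositiveSubproducts-neg {n} v a<0 = begin
    scaledPositiveSubproducts _ v Nat.+ positiveSubproducts v
      ≡⟨ cong (Nat._+ positiveSubproducts v) (count-cong (λ s → isPos-*-neg (∏ v s) a<0) (subsets n)) ⟩
    count (λ s → isPos (- ∏ v s)) (subsets n) Nat.+ positiveSubproducts v
      ≤⟨ count-disjoint (λ s → isPos[-x]∧isPos[x]≡false (∏ v s)) (subsets n) ⟩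
    length (subsets n)
      ≡⟨ length-subsets n ⟩
    2 ^ n ∎
    where open ℕₚ.≤-Reasoning

  2*positiveSubproducts≤ : ∀ {n} (v : Vector Carrier (Nat.suc n)) →
    scaledPositiveSubproducts (head v) (tail v) Nat.+ positiveSubproducts (tail v) ≤ 2 ^ n →
    2 Nat.* positiveSubproducts v ≤ 2 ^ Nat.suc n
  2*positiveSubproducts≤ {n} v bound =
    subst (λ k → 2 Nat.* k ≤ 2 ^ Nat.suc n) (sym (positiveSubproducts-suc v)) (ℕₚ.*-monoʳ-≤ 2 bound)

  ¬allPos⇒2*positiveSubproducts≤ : ∀ {n} (v : Vector Carrier n) → allPos v ≡ false →
                                   2 Nat.* positiveSubproducts v ≤ 2 ^ n
  ¬allPos⇒2*positiveSubproducts≤ {Nat.suc n} v ¬allPos-v with compare 0# (head v)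
  ... | tri< 0<v₀ _ _ = 2*positiveSubproducts≤ v (begin
    scaledPositiveSubproducts (head v) (tail v) Nat.+ positiveSubproducts (tail v)
      ≡⟨ cong (Nat._+ positiveSubproducts (tail v)) (scaledPositiveSubproducts-pos (tail v) 0<v₀) ⟩
    positiveSubproducts (tail v) Nat.+ positiveSubproducts (tail v)
      ≡⟨ cong (positiveSubproducts (tail v) Nat.+_) (ℕₚ.+-identityʳ _) ⟨
    2 Nat.* positiveSubproducts (tail v)
      ≤⟨ ¬allPos⇒2*positiveSubproducts≤ (tail v) ¬allPos-v ⟩
    2 ^ n ∎)
    where open ℕₚ.≤-Reasoning
  ... | tri≈ _ 0≡v₀ _ = 2*positiveSubproducts≤ v
    (subst (λ k → k Nat.+ positiveSubproducts (tail v) ≤ 2 ^ n)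
      (sym (scaledPositiveSubproducts-zero (tail v) 0≡v₀)) (positiveSubproducts≤ (tail v)))
  ... | tri> _ _ v₀<0 = 2*positiveSubproducts≤ v (scaledPositiveSubproducts-neg (tail v) v₀<0)

  positive? : Sign → Bool
  positive? pos = true
  positive? _   = false

  isPos≡positive?-sign : ∀ x → isPos x ≡ positive? (sign x)
  isPos≡positive?-sign x with compare 0# x | compare x 0#
  ... | tri< _   _ _ | tri> _ _ _   = refl
  ... | tri< 0<x _ _ | tri< _ _ 0≮x = ⊥-elim (0≮x 0<x)
  ... | tri< 0<x _ _ | tri≈ _ _ 0≮x = ⊥-elim (0≮x 0<x)
  ... | tri≈ 0≮x _ _ | tri> _ _ 0<x = ⊥-elim (0≮x 0<x)
  ... | tri> 0≮x _ _ | tri> _ _ 0<x = ⊥-elim (0≮x 0<x)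
  ... | tri≈ _ _ _   | tri< _ _ _   = refl
  ... | tri≈ _ _ _   | tri≈ _ _ _   = refl
  ... | tri> _ _ _   | tri< _ _ _   = refl
  ... | tri> _ _ _   | tri≈ _ _ _   = refl

  snoc-last : ∀ {r} (ρ : Vector Carrier r) c → snoc ρ c (fromℕ r) ≡ c
  snoc-last {Nat.zero}  ρ c = refl
  snoc-last {Nat.suc r} ρ c = snoc-last (tail ρ) c

  module _ {n₁ n₂ : ℕ} where

    onPositive : ∀ {r} → Sign → Protocol n₁ n₂ r → Protocol n₁ n₂ r
    onPositive pos k = k
    onPositive _   _ = leaf false

    run-onPositive : ∀ {r} s (k : Protocol n₁ n₂ r) ρ x y →
                     run (onPositive s k) ρ x y ≡ positive? s ∧ run k ρ x y
    run-onPositive pos k ρ x y = refl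
    run-onPositive zer k ρ x y = refl
    run-onPositive neg k ρ x y = refl

    onPositive-depth : ∀ {r d} s {k : Protocol n₁ n₂ r} → DepthLeq d k → DepthLeq d (onPositive s k)
    onPositive-depth pos k≤d = k≤d
    onPositive-depth zer _   = leaf≤
    onPositive-depth neg _   = leaf≤

    -- The single test polynomial is the variable Q_{r+1}, i.e. the value just computed.
    checkAllPositive : ∀ {r} → List (Poly n₁ ⊎ Poly n₂) → Protocol n₁ n₂ r
    checkAllPositive     []       = leaf true
    checkAllPositive {r} (q ∷ qs) =
      node q 1 (λ _ → var (fromℕ r)) (λ σ → onPositive (σ zero) (checkAllPositive qs))

    run-checkAllPositive : ∀ {r} qs (ρ : Vector Carrier r) x y →
                           run (checkAllPositive qs) ρ x y ≡ all (λ q → isPos (evalQ q x y)) qs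
    run-checkAllPositive     []       ρ x y = refl
    run-checkAllPositive {r} (q ∷ qs) ρ x y = begin
      run (onPositive (sign (snoc ρ c (fromℕ r))) (checkAllPositive qs)) (snoc ρ c) x y
        ≡⟨ cong (λ a → run (onPositive (sign a) (checkAllPositive qs)) (snoc ρ c) x y) (snoc-last ρ c) ⟩
      run (onPositive (sign c) (checkAllPositive qs)) (snoc ρ c) x y
        ≡⟨ run-onPositive (sign c) (checkAllPositive qs) (snoc ρ c) x y ⟩
      positive? (sign c) ∧ run (checkAllPositive qs) (snoc ρ c) x y
        ≡⟨ cong₂ _∧_ (sym (isPos≡positive?-sign c)) (run-checkAllPositive qs (snoc ρ c) x y) ⟩
      isPos c ∧ all (λ q → isPos (evalQ q x y)) qs ∎
      where
        c : Carrier
        c = evalQ q x y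
        open ≡-Reasoning

    checkAllPositive-depth : ∀ {r} qs → DepthLeq (length qs) (checkAllPositive {r} qs)
    checkAllPositive-depth []       = leaf≤
    checkAllPositive-depth (q ∷ qs) = node≤ (λ σ → onPositive-depth (σ zero) (checkAllPositive-depth qs))

  two≡2·1 : two ≡ 2 · 1#
  two≡2·1 = cong (1# +_) (sym (+-identityʳ 1#))

  three*x≡3·x : ∀ x → three * x ≡ 3 · x
  three*x≡3·x x = begin
    (1# + 1# + 1#) * x     ≡⟨ cong (_* x) (+-assoc 1# 1# 1#) ⟩
    (1# + (1# + 1#)) * x   ≡⟨ cong (λ a → (1# + (1# + a)) * x) (+-identityʳ 1#) ⟨
    (3 · 1#) * x           ≡⟨ ×-assoc-* 3 1# x ⟩
    3 · (1# * x)           ≡⟨ cong (3 ·_) (*-identityˡ x) ⟩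
    3 · x                  ∎
    where open ≡-Reasoning

  two<three*[c·u] : ∀ n c {u} → n · u ≡ 1# → 0# < u → 2 Nat.* n Nat.< 3 Nat.* c → two < three * (c · u)
  two<three*[c·u] n c {u} n·u≡1 0<u 2n<3c = begin-strict
    two               ≡⟨ two≡2·1 ⟩
    2 · 1#            ≡⟨ cong (2 ·_) n·u≡1 ⟨
    2 · (n · u)       ≡⟨ ×-assocˡ u 2 n ⟩
    (2 Nat.* n) · u   <⟨ ×-monoˡ-< 0<u 2n<3c ⟩
    (3 Nat.* c) · u   ≡⟨ ×-assocˡ u 3 c ⟨
    3 · (c · u)       ≡⟨ three*x≡3·x (c · u) ⟨
    three * (c · u)   ∎
    where open StrictReasoning <-strictPartialOrder

  sumR-lookup : ∀ {W : Set} (f : W → Bool) a (ws : List W) →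
                sumR {length ws} (λ i → if-correct (f (lookup ws i)) a) ≡ count f ws · a
  sumR-lookup f a []       = refl
  sumR-lookup f a (w ∷ ws) with f w
  ... | true  = cong (a +_) (sumR-lookup f a ws)
  ... | false = trans (+-identityˡ _) (sumR-lookup f a ws)

  uniformMixture : ∀ {n₁ n₂ d} {S : Subset n₁ n₂} {W : Set}
    (protocol : W → Protocol n₁ n₂ 0) (ws : List W) →
    (∀ w → DepthLeq d (protocol w)) →
    (∀ x y → 3 Nat.* count (λ w → not (beq (run (protocol w) (λ ()) x y) (S x y))) ws Nat.< length ws) →
    ProbCC≤ n₁ n₂ S d
  uniformMixture {n₁} {n₂} {S = S} {W} protocol ws protocol≤d fewErrors = record
    { m       = length ws
    ; C       = protocol ∘ lookup ws
    ; p       = λ _ → u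
    ; p≥0     = λ _ → inj₁ 0<u
    ; sum=1   = trans (sumR-lookup (λ _ → true) u ws) (trans (cong (_· u) (count-true ws)) N·u≡1)
    ; depth   = protocol≤d ∘ lookup ws
    ; correct = λ x y → subst (λ P → two < three * P) (sym (sumR-lookup (correct x y) u ws))
        (two<three*[c·u] N (count (correct x y) ws) N·u≡1 0<u (mostlyCorrect x y))
    }
    where
      correct : Vector Carrier n₁ → Vector Carrier n₂ → W → Bool
      correct x y w = beq (run (protocol w) (λ ()) x y) (S x y)
      mostlyCorrect : ∀ x y → 2 Nat.* length ws Nat.< 3 Nat.* count (correct x y) ws
      mostlyCorrect x y = twoThirds-of (count (not ∘ correct x y) ws) (count (correct x y) ws)
                                       (count-not (correct x y) ws) (fewErrors x y)
      N : ℕ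
      N = length ws
      1/N : Σ Carrier (λ u → N · 1# * u ≡ 1# × 0# < u)
      1/N = positive-inverse (×-pos {N} (ℕₚ.m<n⇒0<n (fewErrors (λ _ → 0#) (λ _ → 0#))) 0<1)
      u : Carrier
      u = proj₁ 1/N
      0<u : 0# < u
      0<u = proj₂ (proj₂ 1/N)
      N·u≡1 : N · u ≡ 1#
      N·u≡1 = trans (cong (N ·_) (sym (*-identityˡ u))) (trans (sym (×-assoc-* N 1# u)) (proj₁ (proj₂ 1/N)))

  module PositiveOrthant (n₁ n₂ : ℕ) where

    Choice : Set
    Choice = (Vector Bool n₁ × Vector Bool n₁) × (Vector Bool n₂ × Vector Bool n₂)

    subsetPairs : ∀ n → List (Vector Bool n × Vector Bool n)
    subsetPairs n = cartesianProduct (subsets n) (subsets n)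

    choices : List Choice
    choices = cartesianProduct (subsetPairs n₁) (subsetPairs n₂)

    subproductTests : Choice → List (Poly n₁ ⊎ Poly n₂)
    subproductTests ((s , s′) , (t , t′)) =
      inj₁ (monomial s) ∷ inj₁ (monomial s′) ∷ inj₂ (monomial t) ∷ inj₂ (monomial t′) ∷ []

    subproductTest : Choice → Protocol n₁ n₂ 0
    subproductTest = checkAllPositive ∘ subproductTests

    bothPositive : ∀ {n} → Vector Carrier n → Vector Bool n × Vector Bool n → Bool
    bothPositive v (s , s′) = isPos (∏ v s) ∧ isPos (∏ v s′)

    accepts : Vector Carrier n₁ → Vector Carrier n₂ → Choice → Bool
    accepts x y (S₁ , S₂) = bothPositive x S₁ ∧ bothPositive y S₂

    run-subproductTest : ∀ w x y → run (subproductTest w) (λ ()) x y ≡ accepts x y w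
    run-subproductTest w@((s , s′) , (t , t′)) x y = begin
      run (subproductTest w) (λ ()) x y
        ≡⟨ run-checkAllPositive (subproductTests w) (λ ()) x y ⟩
      p ∧ (p′ ∧ (q ∧ (q′ ∧ true)))
        ≡⟨ cong (λ b → p ∧ (p′ ∧ (q ∧ b))) (∧-identityʳ q′) ⟩
      p ∧ (p′ ∧ (q ∧ q′))
        ≡⟨ ∧-assoc p p′ (q ∧ q′) ⟨
      (p ∧ p′) ∧ (q ∧ q′)
        ≡⟨ cong₂ _∧_ (cong₂ _∧_ (cong isPos (eval-monomial s x)) (cong isPos (eval-monomial s′ x)))
                     (cong₂ _∧_ (cong isPos (eval-monomial t y)) (cong isPos (eval-monomial t′ y))) ⟩
      accepts x y w ∎
      where
        p p′ q q′ : Bool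
        p  = isPos (eval (monomial s) x)
        p′ = isPos (eval (monomial s′) x)
        q  = isPos (eval (monomial t) y)
        q′ = isPos (eval (monomial t′) y)
        open ≡-Reasoning

    count-accepts : ∀ x y → count (accepts x y) choices ≡
      (positiveSubproducts x Nat.* positiveSubproducts x) Nat.* (positiveSubproducts y Nat.* positiveSubproducts y)
    count-accepts x y =
      trans (count-cartesianProduct (bothPositive x) (bothPositive y) (subsetPairs n₁) (subsetPairs n₂))
      (cong₂ Nat._*_ (count-cartesianProduct _ _ (subsets n₁) (subsets n₁))
                     (count-cartesianProduct _ _ (subsets n₂) (subsets n₂)))

    length-subsetPairs : ∀ n → length (subsetPairs n) ≡ 2 ^ n Nat.* 2 ^ n
    length-subsetPairs n = trans (length-cartesianProduct (subsets n) (subsets n))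
                                 (cong₂ Nat._*_ (length-subsets n) (length-subsets n))

    length-choices : length choices ≡ (2 ^ n₁ Nat.* 2 ^ n₁) Nat.* (2 ^ n₂ Nat.* 2 ^ n₂)
    length-choices = trans (length-cartesianProduct (subsetPairs n₁) (subsetPairs n₂))
                           (cong₂ Nat._*_ (length-subsetPairs n₁) (length-subsetPairs n₂))

    accepts-inside : ∀ {x y} → allPos x ≡ true → allPos y ≡ true → ∀ w → accepts x y w ≡ true
    accepts-inside {x} {y} allPos-x allPos-y ((s , s′) , (t , t′)) = cong₂ _∧_
      (cong₂ _∧_ (allPos⇒isPos-∏ x allPos-x s) (allPos⇒isPos-∏ x allPos-x s′))
      (cong₂ _∧_ (allPos⇒isPos-∏ y allPos-y t) (allPos⇒isPos-∏ y allPos-y t′))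

    4*accepting≤length : ∀ {x y} → allPos x ≡ false ⊎ allPos y ≡ false →
                         4 Nat.* count (accepts x y) choices ≤ length choices
    4*accepting≤length {x} {y} (inj₁ ¬allPos-x) =
      subst₂ (λ a N → 4 Nat.* a ≤ N) (sym (count-accepts x y)) (sym length-choices)
        (quarter-of-product (positiveSubproducts x) (positiveSubproducts y)
          (¬allPos⇒2*positiveSubproducts≤ x ¬allPos-x) (positiveSubproducts≤ y))
    4*accepting≤length {x} {y} (inj₂ ¬allPos-y) =
      subst₂ (λ a N → 4 Nat.* a ≤ N)
        (sym (trans (count-accepts x y) (ℕₚ.*-comm (positiveSubproducts x Nat.* _) _)))
        (sym (trans length-choices (ℕₚ.*-comm (2 ^ n₁ Nat.* 2 ^ n₁) _)))
        (quarter-of-product (positiveSubproducts y) (positiveSubproducts x)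
          (¬allPos⇒2*positiveSubproducts≤ y ¬allPos-y) (positiveSubproducts≤ x))

    errors : Vector Carrier n₁ → Vector Carrier n₂ → ℕ
    errors x y = count (λ w → not (beq (run (subproductTest w) (λ ()) x y) (T n₁ n₂ x y))) choices

    errors-inside : ∀ {x y} → allPos x ≡ true → allPos y ≡ true → errors x y ≡ 0
    errors-inside {x} {y} allPos-x allPos-y = count-none
      (λ w → cong₂ (λ a b → not (beq a b))
                   (trans (run-subproductTest w x y) (accepts-inside allPos-x allPos-y w))
                   (cong₂ _∧_ allPos-x allPos-y))
      choices

    errors-outside : ∀ {x y} → T n₁ n₂ x y ≡ false → errors x y ≡ count (accepts x y) choices
    errors-outside {x} {y} x,y∉T = count-cong
      (λ w → trans (cong₂ (λ a b → not (beq a b)) (run-subproductTest w x y) x,y∉T)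
                   (not-beq-false (accepts x y w)))
      choices
      where
        not-beq-false : ∀ b → not (beq b false) ≡ b
        not-beq-false true  = refl
        not-beq-false false = refl

    4*errors≤length : ∀ x y → 4 Nat.* errors x y ≤ length choices
    4*errors≤length x y = by-cases (allPos x) (allPos y) refl refl
      where
        by-cases : ∀ a b → allPos x ≡ a → allPos y ≡ b → 4 Nat.* errors x y ≤ length choices
        by-cases true  true  allPos-x allPos-y =
          subst (λ e → 4 Nat.* e ≤ length choices) (sym (errors-inside allPos-x allPos-y)) Nat.z≤n
        by-cases false _     allPos-x _        =
          subst (λ e → 4 Nat.* e ≤ length choices) (sym (errors-outside (cong (_∧ allPos y) allPos-x)))
            (4*accepting≤length (inj₁ allPos-x))
        by-cases true  false allPos-x allPos-y =
          subst (λ e → 4 Nat.* e ≤ length choices) (sym (errors-outside (cong₂ _∧_ allPos-x allPos-y)))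
            (4*accepting≤length (inj₂ allPos-y))

    0<length-choices : 0 Nat.< length choices
    0<length-choices = subst (0 Nat.<_) (sym length-choices)
      (ℕₚ.*-mono-≤ (ℕₚ.*-mono-≤ (ℕₚ.m^n>0 2 n₁) (ℕₚ.m^n>0 2 n₁))
                   (ℕₚ.*-mono-≤ (ℕₚ.m^n>0 2 n₂) (ℕₚ.m^n>0 2 n₂)))

    probCC≤4 : ProbCC≤ n₁ n₂ (T n₁ n₂) 4
    probCC≤4 = uniformMixture subproductTest choices (λ _ → checkAllPositive-depth _)
      (λ x y → 4*m≤n⇒3*m<n (errors x y) (4*errors≤length x y) 0<length-choices)

proposition2 : (R : RealField) → (n₁ n₂ : ℕ) → 1 ≤ n₁ → 1 ≤ n₂ →
               Over.ProbCC≤ R n₁ n₂ (Over.T R n₁ n₂) 4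
proposition2 R n₁ n₂ _ _ = Recognition.PositiveOrthant.probCC≤4 R n₁ n₂
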